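{- Let $G_1=(V_1,E_1)$ and $G_2=(V_2,E_2)$ be graphs. Then $\mathrm{thin}(G_1\times G_2)\leq \mathrm{indthin}(G_1\times G_2)\leq \mathrm{indthin}(G_1)|V_2|\leq \mathrm{thin}(G_1)\chi(G_1)|V_2|$ and $\mathrm{pthin}(G_1\times G_2)\leq \mathrm{indpthin}(G_1\times G_2)\leq \mathrm{indpthin}(G_1)|V_2|\leq \mathrm{pthin}(G_1)\chi(G_1)|V_2|$.
   Context: Graphs are finite, simple, undirected; $\chi$ is the chromatic number. The direct (tensor) product $G_1\times G_2$ has vertex set $V_1\times V_2$, and $(u_1,u_2)$, $(v_1,v_2)$ are adjacent iff $u_1v_1\in E_1$ and $u_2v_2\in E_2$. For a graph $G=(V,E)$, an ordering $v_1,\dots,v_n$ of $V$ and a partition of $V$ are consistent if for every $r<s<t$, whenever $v_r,v_s$ are in the same class and $v_tv_r\in E$, then $v_tv_s\in E$; strongly consistent if moreover for every $r<s<t$, whenever $v_s,v_t$ are in the same class and $v_tv_r\in E$, then $v_sv_r\in E$. $\mathrm{thin}(G)$ (resp. $\mathrm{pthin}(G)$) is the minimum number of classes of a partition of $V$ consistent (resp. strongly consistent) with some ordering of $V$; $\mathrm{indthin}$ (resp. $\mathrm{indpthin}$) is the same minimum when each class is additionally required to be an independent set. -}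

module Defs where

open import Data.Nat using (ℕ; _*_; _≤_)
open import Data.Fin using (Fin; _<_; remQuot)
open import Data.Fin.Permutation using (Permutation′; _⟨$⟩ʳ_)
open import Data.Product using (Σ; _×_; proj₁; proj₂; _,_)
open import Relation.Binary.PropositionalEquality using (_≡_)
open import Relation.Nullary using (¬_; Dec)
open import Level using (0ℓ) renaming (suc to lsuc)

record Graph : Set₁ where
  field
    size  : ℕ
    Adj   : Fin size → Fin size → Set
    adj?  : ∀ u v → Dec (Adj u v)
    sym   : ∀ {u v} → Adj u v → Adj v u
    irrefl : ∀ {u} → ¬ Adj u u
open Graph public

-- Direct (tensor) product; vertex (u₁,u₂) is encoded as an element of
-- Fin (size G₁ * size G₂) via remQuot / combine.
-- first / second coordinate of a product vertex
fst' : (G₁ G₂ : Graph) → Fin (size G₁ * size G₂) → Fin (size G₁)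
fst' G₁ G₂ x = proj₁ (remQuot {size G₁} (size G₂) x)

snd' : (G₁ G₂ : Graph) → Fin (size G₁ * size G₂) → Fin (size G₂)
snd' G₁ G₂ x = proj₂ (remQuot {size G₁} (size G₂) x)

_×ᵍ_ : Graph → Graph → Graph
G₁ ×ᵍ G₂ = record
  { size = size G₁ * size G₂
  ; Adj = λ x y → Adj G₁ (fst' G₁ G₂ x) (fst' G₁ G₂ y) × Adj G₂ (snd' G₁ G₂ x) (snd' G₁ G₂ y)
  ; adj? = λ x y → dec× (adj? G₁ (fst' G₁ G₂ x) (fst' G₁ G₂ y)) (adj? G₂ (snd' G₁ G₂ x) (snd' G₁ G₂ y))
  ; sym = λ p → sym G₁ (proj₁ p) , sym G₂ (proj₂ p)
  ; irrefl = λ p → irrefl G₁ (proj₁ p)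
  }
  where
  open import Relation.Nullary.Decidable using () renaming (_×-dec_ to dec×)

-- An ordering of V is a permutation: v_i = ord ⟨$⟩ʳ i.
-- A partition of V into (at most) k classes is a map c : Fin size → Fin k.

Consistent : (G : Graph) → Permutation′ (size G) → {k : ℕ} → (Fin (size G) → Fin k) → Set
Consistent G ord c = ∀ (r s t : Fin (size G)) → r < s → s < t →
  c (v r) ≡ c (v s) → Adj G (v t) (v r) → Adj G (v t) (v s)
  where v = ord ⟨$⟩ʳ_

StronglyConsistent : (G : Graph) → Permutation′ (size G) → {k : ℕ} → (Fin (size G) → Fin k) → Set
StronglyConsistent G ord c = Consistent G ord c ×
  (∀ (r s t : Fin (size G)) → r < s → s < t →
    c (v s) ≡ c (v t) → Adj G (v t) (v r) → Adj G (v s) (v r))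
  where v = ord ⟨$⟩ʳ_

IndependentClasses : (G : Graph) → {k : ℕ} → (Fin (size G) → Fin k) → Set
IndependentClasses G c = ∀ u v → c u ≡ c v → ¬ Adj G u v

ThinWith IndThinWith PThinWith IndPThinWith ColWith : Graph → ℕ → Set
ThinWith G k = Σ (Permutation′ (size G)) λ ord → Σ (Fin (size G) → Fin k) λ c →
  Consistent G ord c
IndThinWith G k = Σ (Permutation′ (size G)) λ ord → Σ (Fin (size G) → Fin k) λ c →
  Consistent G ord c × IndependentClasses G c
PThinWith G k = Σ (Permutation′ (size G)) λ ord → Σ (Fin (size G) → Fin k) λ c →
  StronglyConsistent G ord c
IndPThinWith G k = Σ (Permutation′ (size G)) λ ord → Σ (Fin (size G) → Fin k) λ c →
  StronglyConsistent G ord c × IndependentClasses G c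
ColWith G k = Σ (Fin (size G) → Fin k) λ c → IndependentClasses G c

IsMin : (ℕ → Set) → ℕ → Set
IsMin P k = P k × (∀ m → P m → k ≤ m)

IsThin IsIndThin IsPThin IsIndPThin IsChi : Graph → ℕ → Set
IsThin G = IsMin (ThinWith G)
IsIndThin G = IsMin (IndThinWith G)
IsPThin G = IsMin (PThinWith G)
IsIndPThin G = IsMin (IndPThinWith G)
IsChi G = IsMin (ColWith G)

module Submission where

--  * Forgetting independence turns an independent (strongly) consistent
--    partition into a (strongly) consistent one, so thin ≤ indthin and
--    pthin ≤ indpthin for every graph, in particular for G₁ × G₂.
--  * Refining a (strongly) consistent partition keeps it (strongly)
--    consistent; intersecting its classes with those of a proper colouring
--    makes the classes independent.  Hence indthin(G₁) ≤ thin(G₁) χ(G₁), and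
--    likewise for the strong versions.
--  * From an independent (strongly) consistent partition c₁ of G₁ with
--    ordering σ we build one of G₁ × G₂ with |V₂| times as many classes:
--    order the product lexicographically, first by σ on the first coordinate,
--    and put (u₁,u₂) in the class (c₁ u₁, u₂).  Two distinct vertices of one
--    class have different first coordinates, so consistency is inherited from
--    G₁ coordinatewise; independence of c₁ handles the boundary case where the
--    remaining vertex shares its first coordinate with one of the other two.

open import Defs
open import Data.Nat using (ℕ; _*_; _≤_)
import Data.Nat.Properties as ℕ
open import Data.Fin using (Fin; combine; quotient; remainder)
  renaming (_<_ to _<ᶠ_; _≤_ to _≤ᶠ_)
open import Data.Fin.Properties
  using (remQuot-combine; combine-remQuot; combine-injectiveˡ;
         combine-injectiveʳ; combine-monoˡ-<; <-cmp; ≤∧≢⇒<; <-asym; <⇒≢)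
open import Data.Fin.Permutation using (Permutation′; _⟨$⟩ʳ_; _⟨$⟩ˡ_; permutation; inverseˡ; inverseʳ)
open import Data.Product using (_×_; _,_; proj₁; proj₂)
open import Data.Empty using (⊥-elim)
open import Relation.Binary.Definitions using (tri<; tri≈; tri>)
open import Relation.Binary.PropositionalEquality
  using (_≡_; refl; trans; cong; cong₂; subst; subst₂; module ≡-Reasoning)
  renaming (sym to ≡-sym)

min-mono : ∀ {P Q : ℕ → Set} {k l : ℕ} →
           IsMin P k → IsMin Q l → (∀ {m} → Q m → P m) → k ≤ l
min-mono (_ , least) (witness , _) Q⇒P = least _ (Q⇒P witness)

module Lexicographic (n₁ n₂ : ℕ) where

  first : Fin (n₁ * n₂) → Fin n₁
  first = quotient n₂

  second : Fin (n₁ * n₂) → Fin n₂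
  second = remainder {n₁} n₂

  first-combine : ∀ i j → first (combine i j) ≡ i
  first-combine i j = cong proj₁ (remQuot-combine {n₁} {n₂} i j)

  second-combine : ∀ i j → second (combine i j) ≡ j
  second-combine i j = cong proj₂ (remQuot-combine {n₁} {n₂} i j)

  combine-coordinates : ∀ x → combine (first x) (second x) ≡ x
  combine-coordinates = combine-remQuot {n₁} n₂

  coordinates-injective : ∀ {x y} → first x ≡ first y → second x ≡ second y → x ≡ y
  coordinates-injective {x} {y} first≡ second≡ = begin
    x                              ≡⟨ ≡-sym (combine-coordinates x) ⟩
    combine (first x) (second x)   ≡⟨ cong₂ combine first≡ second≡ ⟩
    combine (first y) (second y)   ≡⟨ combine-coordinates y ⟩
    y                              ∎
    where open ≡-Reasoning

  first-mono : ∀ {x y} → x <ᶠ y → first x ≤ᶠ first y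
  first-mono {x} {y} x<y = ℕ.≮⇒≥ λ fy<fx → <-asym x<y (y<x fy<fx)
    where
    y<x : first y <ᶠ first x → y <ᶠ x
    y<x fy<fx = subst₂ _<ᶠ_ (combine-coordinates y) (combine-coordinates x)
                  (combine-monoˡ-< (second y) (second x) fy<fx)

  first-strict : ∀ {x y} → x <ᶠ y → second x ≡ second y → first x <ᶠ first y
  first-strict x<y second≡ =
    ≤∧≢⇒< (first-mono x<y) (λ first≡ → <⇒≢ x<y (coordinates-injective first≡ second≡))

  onFirst : (Fin n₁ → Fin n₁) → Fin (n₁ * n₂) → Fin (n₁ * n₂)
  onFirst f x = combine (f (first x)) (second x)

  onFirst-inverse : ∀ f g → (∀ i → f (g i) ≡ i) → ∀ x → onFirst f (onFirst g x) ≡ x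
  onFirst-inverse f g fg x = coordinates-injective
    (begin
      first (onFirst f (onFirst g x))   ≡⟨ first-combine (f (first (onFirst g x))) _ ⟩
      f (first (onFirst g x))           ≡⟨ cong f (first-combine (g (first x)) (second x)) ⟩
      f (g (first x))                   ≡⟨ fg _ ⟩
      first x                           ∎)
    (trans (second-combine (f (first (onFirst g x))) _) (second-combine (g (first x)) _))
    where open ≡-Reasoning

  lexOrder : Permutation′ n₁ → Permutation′ (n₁ * n₂)
  lexOrder σ = permutation (onFirst (σ ⟨$⟩ʳ_)) (onFirst (σ ⟨$⟩ˡ_))
    (onFirst-inverse (σ ⟨$⟩ʳ_) (σ ⟨$⟩ˡ_) (λ _ → inverseʳ σ))
    (onFirst-inverse (σ ⟨$⟩ˡ_) (σ ⟨$⟩ʳ_) (λ _ → inverseˡ σ))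

  lexOrder-first : ∀ σ x → first (lexOrder σ ⟨$⟩ʳ x) ≡ σ ⟨$⟩ʳ first x
  lexOrder-first σ x = first-combine (σ ⟨$⟩ʳ first x) (second x)

  lexOrder-second : ∀ σ x → second (lexOrder σ ⟨$⟩ʳ x) ≡ second x
  lexOrder-second σ x = second-combine (σ ⟨$⟩ʳ first x) (second x)

indThin⇒thin : ∀ {G k} → IndThinWith G k → ThinWith G k
indThin⇒thin (ord , c , consistent , _) = ord , c , consistent

indPThin⇒pThin : ∀ {G k} → IndPThinWith G k → PThinWith G k
indPThin⇒pThin (ord , c , strong , _) = ord , c , strong

Refines : ∀ {n k k′} → (Fin n → Fin k′) → (Fin n → Fin k) → Set
Refines c′ c = ∀ x y → c′ x ≡ c′ y → c x ≡ c y

-- Both conditions of (strong) consistency only require something of pairs in a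
-- common class, so they pass to refinements.
refine-consistent : ∀ {G ord k k′} {c : Fin (size G) → Fin k} {c′ : Fin (size G) → Fin k′} →
  Refines c′ c → Consistent G ord c → Consistent G ord c′
refine-consistent {ord = ord} refines consistent r s t r<s s<t same =
  consistent r s t r<s s<t (refines (ord ⟨$⟩ʳ r) (ord ⟨$⟩ʳ s) same)

refine-stronglyConsistent : ∀ {G ord k k′} {c : Fin (size G) → Fin k} {c′ : Fin (size G) → Fin k′} →
  Refines c′ c → StronglyConsistent G ord c → StronglyConsistent G ord c′
refine-stronglyConsistent {G} {ord} refines (consistent , strong) =
  refine-consistent {G} {ord} refines consistent ,
  λ r s t r<s s<t same → strong r s t r<s s<t (refines (ord ⟨$⟩ʳ s) (ord ⟨$⟩ʳ t) same)

_⊓_ : ∀ {n k l} → (Fin n → Fin k) → (Fin n → Fin l) → Fin n → Fin (k * l)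
(c ⊓ d) x = combine (c x) (d x)

⊓-refinesˡ : ∀ {n k l} (c : Fin n → Fin k) (d : Fin n → Fin l) → Refines (c ⊓ d) c
⊓-refinesˡ c d x y = combine-injectiveˡ (c x) (d x) (c y) (d y)

⊓-refinesʳ : ∀ {n k l} (c : Fin n → Fin k) (d : Fin n → Fin l) → Refines (c ⊓ d) d
⊓-refinesʳ c d x y = combine-injectiveʳ (c x) (d x) (c y) (d y)

refine-independent : ∀ {G k k′} {c : Fin (size G) → Fin k} {c′ : Fin (size G) → Fin k′} →
  Refines c′ c → IndependentClasses G c → IndependentClasses G c′
refine-independent refines independent x y same = independent x y (refines x y same)

thin×col⇒indThin : ∀ {G t χ} → ThinWith G t → ColWith G χ → IndThinWith G (t * χ)
thin×col⇒indThin {G} (ord , c , consistent) (col , proper) =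
  ord , c ⊓ col , refine-consistent {G} {ord} (⊓-refinesˡ c col) consistent ,
  refine-independent {G} (⊓-refinesʳ c col) proper

pThin×col⇒indPThin : ∀ {G t χ} → PThinWith G t → ColWith G χ → IndPThinWith G (t * χ)
pThin×col⇒indPThin {G} (ord , c , strong) (col , proper) =
  ord , c ⊓ col , refine-stronglyConsistent {G} {ord} (⊓-refinesˡ c col) strong ,
  refine-independent {G} (⊓-refinesʳ c col) proper

-- With independent classes the consistency conditions extend to the boundary
-- cases s = t (resp. r = s): there the edge v_t v_r would join two vertices of
-- one class.
module _ (G : Graph) (ord : Permutation′ (size G)) {k : ℕ} {c : Fin (size G) → Fin k}
         (independent : IndependentClasses G c) where
  private
    v : Fin (size G) → Fin (size G)
    v = ord ⟨$⟩ʳ_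

  consistent-≤ : Consistent G ord c → ∀ {r s t} → r <ᶠ s → s ≤ᶠ t →
    c (v r) ≡ c (v s) → Adj G (v t) (v r) → Adj G (v t) (v s)
  consistent-≤ consistent {r} {s} {t} r<s s≤t same edge with <-cmp s t
  ... | tri< s<t _ _ = consistent r s t r<s s<t same edge
  ... | tri≈ _ refl _ = ⊥-elim (independent (v r) (v s) same (sym G edge))
  ... | tri> _ _ t<s = ⊥-elim (ℕ.<⇒≱ t<s s≤t)

  stronglyConsistent-≤ : StronglyConsistent G ord c → ∀ {r s t} → r ≤ᶠ s → s <ᶠ t →
    c (v s) ≡ c (v t) → Adj G (v t) (v r) → Adj G (v s) (v r)
  stronglyConsistent-≤ (_ , strong) {r} {s} {t} r≤s s<t same edge with <-cmp r s
  ... | tri< r<s _ _ = strong r s t r<s s<t same edge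
  ... | tri≈ _ refl _ = ⊥-elim (independent (v r) (v t) same (sym G edge))
  ... | tri> _ _ s<r = ⊥-elim (ℕ.<⇒≱ s<r r≤s)

module LayeredPartition (G₁ G₂ : Graph) (σ : Permutation′ (size G₁))
                        {k : ℕ} (c₁ : Fin (size G₁) → Fin k) where
  open Lexicographic (size G₁) (size G₂)

  π : Permutation′ (size G₁ * size G₂)
  π = lexOrder σ

  layered : Fin (size G₁ * size G₂) → Fin (k * size G₂)
  layered x = combine (c₁ (first x)) (second x)

  private
    w : Fin (size G₁ * size G₂) → Fin (size G₁ * size G₂)
    w = π ⟨$⟩ʳ_

    v : Fin (size G₁) → Fin (size G₁)
    v = σ ⟨$⟩ʳ_

  -- Two vertices of one layered class share the second coordinate, and the
  -- product graph has no loops in G₂: the classes are independent.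
  layered-independent : IndependentClasses (G₁ ×ᵍ G₂) layered
  layered-independent x y same (_ , edge₂) =
    irrefl G₂ (subst (λ z → Adj G₂ z (second y)) second≡ edge₂)
    where
    second≡ : second x ≡ second y
    second≡ = combine-injectiveʳ (c₁ (first x)) (second x) (c₁ (first y)) (second y) same

  same-layer : ∀ a b → layered (w a) ≡ layered (w b) →
               c₁ (v (first a)) ≡ c₁ (v (first b)) × second a ≡ second b
  same-layer a b same =
    subst₂ (λ x y → c₁ x ≡ c₁ y) (lexOrder-first σ a) (lexOrder-first σ b) c≡ ,
    trans (≡-sym (lexOrder-second σ a)) (trans second≡ (lexOrder-second σ b))
    where
    c≡ : c₁ (first (w a)) ≡ c₁ (first (w b))
    c≡ = combine-injectiveˡ (c₁ (first (w a))) _ (c₁ (first (w b))) _ same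
    second≡ : second (w a) ≡ second (w b)
    second≡ = combine-injectiveʳ (c₁ (first (w a))) _ (c₁ (first (w b))) _ same

  edge-split : ∀ a b → Adj (G₁ ×ᵍ G₂) (w a) (w b) →
               Adj G₁ (v (first a)) (v (first b)) × Adj G₂ (second a) (second b)
  edge-split a b (edge₁ , edge₂) =
    subst₂ (Adj G₁) (lexOrder-first σ a) (lexOrder-first σ b) edge₁ ,
    subst₂ (Adj G₂) (lexOrder-second σ a) (lexOrder-second σ b) edge₂

  edge-join : ∀ a b → Adj G₁ (v (first a)) (v (first b)) → Adj G₂ (second a) (second b) →
              Adj (G₁ ×ᵍ G₂) (w a) (w b)
  edge-join a b edge₁ edge₂ =
    subst₂ (Adj G₁) (≡-sym (lexOrder-first σ a)) (≡-sym (lexOrder-first σ b)) edge₁ ,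
    subst₂ (Adj G₂) (≡-sym (lexOrder-second σ a)) (≡-sym (lexOrder-second σ b)) edge₂

  -- Positions r < s in one class have second coordinates equal, hence first
  -- coordinates r₁ < s₁; the first coordinates of r < s < t satisfy
  -- r₁ < s₁ ≤ t₁, so consistency of c₁ (extended by independence) applies.
  layered-consistent : IndependentClasses G₁ c₁ → Consistent G₁ σ c₁ →
                       Consistent (G₁ ×ᵍ G₂) π layered
  layered-consistent independent consistent r s t r<s s<t same edge
    with c≡ , second≡ ← same-layer r s same
       | edge₁ , edge₂ ← edge-split t r edge
    = edge-join t s
        (consistent-≤ G₁ σ independent consistent
           (first-strict r<s second≡) (first-mono s<t) c≡ edge₁)
        (subst (Adj G₂ (second t)) second≡ edge₂)

  -- Symmetrically, the first coordinates satisfy r₁ ≤ s₁ < t₁ for the strong condition.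
  layered-stronglyConsistent : IndependentClasses G₁ c₁ → StronglyConsistent G₁ σ c₁ →
                               StronglyConsistent (G₁ ×ᵍ G₂) π layered
  layered-stronglyConsistent independent strong =
    layered-consistent independent (proj₁ strong) , strong-condition
    where
    strong-condition : ∀ r s t → r <ᶠ s → s <ᶠ t → layered (w s) ≡ layered (w t) →
                       Adj (G₁ ×ᵍ G₂) (w t) (w r) → Adj (G₁ ×ᵍ G₂) (w s) (w r)
    strong-condition r s t r<s s<t same edge
      with c≡ , second≡ ← same-layer s t same
         | edge₁ , edge₂ ← edge-split t r edge
      = edge-join s r
          (stronglyConsistent-≤ G₁ σ independent strong
             (first-mono r<s) (first-strict s<t second≡) c≡ edge₁)
          (subst (λ z → Adj G₂ z (second r)) (≡-sym second≡) edge₂)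

product-indThin : ∀ G₁ G₂ {k} → IndThinWith G₁ k → IndThinWith (G₁ ×ᵍ G₂) (k * size G₂)
product-indThin G₁ G₂ (σ , c₁ , consistent , independent) =
  π , layered , layered-consistent independent consistent , layered-independent
  where open LayeredPartition G₁ G₂ σ c₁

product-indPThin : ∀ G₁ G₂ {k} → IndPThinWith G₁ k → IndPThinWith (G₁ ×ᵍ G₂) (k * size G₂)
product-indPThin G₁ G₂ (σ , c₁ , strong , independent) =
  π , layered , layered-stronglyConsistent independent strong , layered-independent
  where open LayeredPartition G₁ G₂ σ c₁

theorem4p31 : (G₁ G₂ : Graph) →
    (t₁ it₁ p₁ ip₁ χ₁ t₁₂ it₁₂ p₁₂ ip₁₂ : ℕ) →
    IsThin G₁ t₁ → IsIndThin G₁ it₁ → IsPThin G₁ p₁ → IsIndPThin G₁ ip₁ → IsChi G₁ χ₁ →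
    IsThin (G₁ ×ᵍ G₂) t₁₂ → IsIndThin (G₁ ×ᵍ G₂) it₁₂ →
    IsPThin (G₁ ×ᵍ G₂) p₁₂ → IsIndPThin (G₁ ×ᵍ G₂) ip₁₂ →
    (t₁₂ ≤ it₁₂ × it₁₂ ≤ it₁ * size G₂ × it₁ * size G₂ ≤ t₁ * χ₁ * size G₂)
    × (p₁₂ ≤ ip₁₂ × ip₁₂ ≤ ip₁ * size G₂ × ip₁ * size G₂ ≤ p₁ * χ₁ * size G₂)
theorem4p31 G₁ G₂ t₁ it₁ p₁ ip₁ χ₁ t₁₂ it₁₂ p₁₂ ip₁₂
            thin₁ indThin₁ pThin₁ indPThin₁ chi₁ thin₁₂ indThin₁₂ pThin₁₂ indPThin₁₂ =
  ( min-mono thin₁₂ indThin₁₂ (indThin⇒thin {G₁ ×ᵍ G₂})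
  , proj₂ indThin₁₂ _ (product-indThin G₁ G₂ (proj₁ indThin₁))
  , ℕ.*-monoˡ-≤ (size G₂) (proj₂ indThin₁ _ (thin×col⇒indThin {G₁} (proj₁ thin₁) colouring)) )
  , ( min-mono pThin₁₂ indPThin₁₂ (indPThin⇒pThin {G₁ ×ᵍ G₂})
  , proj₂ indPThin₁₂ _ (product-indPThin G₁ G₂ (proj₁ indPThin₁))
  , ℕ.*-monoˡ-≤ (size G₂) (proj₂ indPThin₁ _ (pThin×col⇒indPThin {G₁} (proj₁ pThin₁) colouring)) )
  where
  colouring : ColWith G₁ χ₁
  colouring = proj₁ chi₁
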